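{- Let $L$ be a complete lattice, $F\colon L\to L$ an $\omega$-continuous function, and $\alpha\in L$. There exists a KT witness for $(L,F,\alpha)$ if and only if there exists a $\mathrm{KT}^\omega$ witness for $(L,F,\alpha)$.
   Context: $\omega$-continuous means preserving suprema of increasing $\omega$-chains. A KT witness is an element $x\in L$ with $Fx\le x\le\alpha$. A $\mathrm{KT}^\omega$ witness is an increasing $\omega$-chain $X=(X_0\le X_1\le\cdots)$ in $L$ such that $FX_i\le X_{i+1}$ for all $i\ge 0$ and $X_i\le\alpha$ for all $i\ge 0$ (i.e. $F^\#X\le X\le(\alpha\le\alpha\le\cdots)$ componentwise, where $F^\#(X_0\le X_1\le\cdots)=(\bot\le FX_0\le FX_1\le\cdots)$). -}

module Defs where

open import Level using (Level; suc; _⊔_; Lift; lift; lower)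
open import Data.Nat using (ℕ) renaming (suc to sucℕ)
open import Data.Product using (Σ; _×_)
open import Relation.Binary.Bundles using (Poset)

record CompleteLattice (c ℓ₁ ℓ₂ i : Level) : Set (suc (c ⊔ ℓ₁ ⊔ ℓ₂ ⊔ i)) where
  field
    poset : Poset c ℓ₁ ℓ₂
  open Poset poset public
  field
    ⋁      : {I : Set i} → (I → Carrier) → Carrier
    ⋁-upper : {I : Set i} (f : I → Carrier) (j : I) → f j ≤ ⋁ f
    ⋁-least : {I : Set i} (f : I → Carrier) (x : Carrier) →
              ((j : I) → f j ≤ x) → ⋁ f ≤ x

module _ {c ℓ₁ ℓ₂ i : Level} (L : CompleteLattice c ℓ₁ ℓ₂ i) where
  open CompleteLattice L

  ⋁ω : (ℕ → Carrier) → Carrier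
  ⋁ω X = ⋁ {I = Lift i ℕ} (λ n → X (lower n))

  IsOmegaChain : (ℕ → Carrier) → Set ℓ₂
  IsOmegaChain X = (n : ℕ) → X n ≤ X (sucℕ n)

  OmegaContinuous : (Carrier → Carrier) → Set (c ⊔ ℓ₁ ⊔ ℓ₂)
  OmegaContinuous F = (X : ℕ → Carrier) → IsOmegaChain X →
                      F (⋁ω X) ≈ ⋁ω (λ n → F (X n))

  KTWitness : (Carrier → Carrier) → Carrier → Carrier → Set ℓ₂
  KTWitness F α x = (F x ≤ x) × (x ≤ α)

  KTωWitness : (Carrier → Carrier) → Carrier → (ℕ → Carrier) → Set ℓ₂
  KTωWitness F α X = IsOmegaChain X ×
                     ((n : ℕ) → F (X n) ≤ X (sucℕ n)) ×
                     ((n : ℕ) → X n ≤ α)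

{-# OPTIONS --safe #-}
module Submission where

-- A KT witness x gives the constant chain x ≤ x ≤ ⋯.  Conversely the supremum
-- of a KT^ω witness X is a KT witness: it lies below α, and by ω-continuity
-- F (⋁ X) = ⋁ F Xₙ ≤ ⋁ Xₙ₊₁ ≤ ⋁ X.

open import Defs
open import Level using (Level; lift; lower)
open import Data.Nat using (ℕ) renaming (suc to sucℕ)
open import Data.Product using (Σ; _×_; _,_)
open import Function using (_∘_; const)

module _ {c ℓ₁ ℓ₂ i : Level} (L : CompleteLattice c ℓ₁ ℓ₂ i) where
  open CompleteLattice L

  ⋁ω-upper : (X : ℕ → Carrier) (n : ℕ) → X n ≤ ⋁ω L X
  ⋁ω-upper X n = ⋁-upper _ (lift n)

  ⋁ω-least : (X : ℕ → Carrier) (x : Carrier) → ((n : ℕ) → X n ≤ x) → ⋁ω L X ≤ x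
  ⋁ω-least X x X≤x = ⋁-least _ x (X≤x ∘ lower)

  ⋁ω-shift-≤ : (X Y : ℕ → Carrier) → ((n : ℕ) → Y n ≤ X (sucℕ n)) → ⋁ω L Y ≤ ⋁ω L X
  ⋁ω-shift-≤ X Y Y≤X′ = ⋁ω-least Y (⋁ω L X) (λ n → trans (Y≤X′ n) (⋁ω-upper X (sucℕ n)))

  const-isOmegaChain : (x : Carrier) → IsOmegaChain L (const x)
  const-isOmegaChain x _ = refl

  KTWitness⇒KTωWitness : (F : Carrier → Carrier) {α x : Carrier} →
                         KTWitness L F α x → KTωWitness L F α (const x)
  KTWitness⇒KTωWitness F {x = x} (Fx≤x , x≤α) =
    const-isOmegaChain x , const Fx≤x , const x≤α

  KTωWitness⇒KTWitness : (F : Carrier → Carrier) {α : Carrier} → OmegaContinuous L F →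
                         {X : ℕ → Carrier} → KTωWitness L F α X → KTWitness L F α (⋁ω L X)
  KTωWitness⇒KTWitness F {α} continuous {X} (chain , FX≤X′ , X≤α) =
    trans (reflexive (continuous X chain)) (⋁ω-shift-≤ X (F ∘ X) FX≤X′) ,
    ⋁ω-least X α X≤α

theorem2 : {c ℓ₁ ℓ₂ i : Level} (L : CompleteLattice c ℓ₁ ℓ₂ i) →
    (F : CompleteLattice.Carrier L → CompleteLattice.Carrier L) →
    OmegaContinuous L F →
    (α : CompleteLattice.Carrier L) →
    ((Σ (CompleteLattice.Carrier L) (KTWitness L F α) → Σ (ℕ → CompleteLattice.Carrier L) (KTωWitness L F α))
    × (Σ (ℕ → CompleteLattice.Carrier L) (KTωWitness L F α) → Σ (CompleteLattice.Carrier L) (KTWitness L F α)))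
theorem2 L F continuous _ =
  (λ (x , kt) → const x , KTWitness⇒KTωWitness L F kt) ,
  (λ (X , ktω) → ⋁ω L X , KTωWitness⇒KTWitness L F continuous ktω)
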